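{- For every alphabet $\Sigma$, the category $\mathbf{Aut}_\Sigma$ has finite products. Its terminal object is $\mathbf T=(\mathbf 1,\ast,\mathbf 1,\partial_{\mathbf T},\mathbf 1^\omega)$ with $\partial_{\mathbf T}(-,-,-)=\ast$, and the binary product of $\mathcal A$ and $\mathcal B$ is \[\mathcal A\times\mathcal B=(Q_{\mathcal A}\times Q_{\mathcal B},(q_{0,\mathcal A},q_{0,\mathcal B}),M(\mathcal A)\times M(\mathcal B),\partial,\Omega)\] where $\partial((q,q'),a,(u,v))=(\partial_{\mathcal A}(q,a,u),\partial_{\mathcal B}(q',a,v))$ and $(q_n,q'_n)_n\in\Omega$ iff $(q_n)_n\in\Omega_{\mathcal A}$ and $(q'_n)_n\in\Omega_{\mathcal B}$ (this $\Omega$ is $\omega$-regular). Moreover $\mathcal L(\mathbf T)=\Sigma^\omega$ and $\mathcal L(\mathcal A\times\mathcal B)=\mathcal L(\mathcal A)\cap\mathcal L(\mathcal B)$.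
   Context: An alphabet is a finite nonempty set; $\mathbf 1=\{\ast\}$. A uniform automaton over $\Sigma$ is $\mathcal A=(Q_{\mathcal A},q_{0,\mathcal A},M(\mathcal A),\partial_{\mathcal A},\Omega_{\mathcal A})$ with $Q_{\mathcal A}$ finite, $M(\mathcal A)$ a finite nonempty set of moves, $\partial_{\mathcal A}:Q_{\mathcal A}\times\Sigma\times M(\mathcal A)\to Q_{\mathcal A}$, $\Omega_{\mathcal A}\subseteq Q_{\mathcal A}^\omega$ $\omega$-regular. A run $R\in M(\mathcal A)^\omega$ is accepting on $\sigma\in\Sigma^\omega$ (written $R\Vdash\mathcal A(\sigma)$) if the state sequence $q_0$, $q_{k+1}=\partial_{\mathcal A}(q_k,\sigma(k),R(k))$ lies in $\Omega_{\mathcal A}$; $\mathcal L(\mathcal A)$ is the set of $\sigma$ with an accepting run. Finite-state synchronous functions are those $\Sigma^\omega\to\Gamma^\omega$ induced by deterministic Mealy machines ($(Q,q_0,\partial:Q\times\Sigma\to Q\times\Gamma)$, the $n$-th output being the output on the $n$-th letter from the state reached after the first $n$ letters); streams over product alphabets are identified with tuples of streams. $\mathbf{Aut}_\Sigma$ has uniform automata over $\Sigma$ as objects; a morphism $\mathcal A\to\mathcal B$ is a finite-state synchronous $F:(\Sigma\times M(\mathcal A))^\omega\to M(\mathcal B)^\omega$ such that $F(\sigma,R)\Vdash\mathcal B(\sigma)$ whenever $R\Vdash\mathcal A(\sigma)$; identities are $(\sigma,R)\mapsto R$ and composition is $(G\circ F)(\sigma,R)=G(\sigma,F(\sigma,R))$.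 -}

module Defs where

open import Level using (0ℓ)
open import Data.Nat using (ℕ; zero; suc; _≤_)
open import Data.Fin using (Fin)
open import Data.Bool using (Bool; true)
open import Data.Unit using (⊤; tt)
open import Data.Product using (Σ; ∃; ∃-syntax; _×_; _,_; proj₁; proj₂)
open import Function.Bundles using (_↔_)
open import Relation.Binary.PropositionalEquality using (_≡_)

Stream : Set → Set
Stream X = ℕ → X

Finite : Set → Set
Finite X = Σ ℕ λ n → X ↔ Fin n

record IsAlphabet (S : Set) : Set where
  field
    finite : Finite S
    point  : S

record Buchi (Q : Set) : Set₁ where
  field
    St     : Set
    finSt  : Finite St
    init   : St
    δ      : St → Q → St → Bool
    accept : St → Bool

BuchiAccepts : {Q : Set} → Buchi Q → Stream Q → Set
BuchiAccepts {Q} B x =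
  Σ (Stream (Buchi.St B)) λ r → ( (r 0 ≡ Buchi.init B)
         × (∀ n → Buchi.δ B (r n) (x n) (r (suc n)) ≡ true)
         × (∀ n → ∃[ m ] (n ≤ m × Buchi.accept B (r m) ≡ true)) )

OmegaRegular : {Q : Set} → (Stream Q → Set) → Set₁
OmegaRegular {Q} Ω =
  Σ (Buchi Q) λ B → ∀ x → (Ω x → BuchiAccepts B x) × (BuchiAccepts B x → Ω x)

record Mealy (I O : Set) : Set₁ where
  field
    S     : Set
    finS  : Finite S
    s₀    : S
    step  : S → I → S × O

mealyState : {I O : Set} (M : Mealy I O) → Stream I → ℕ → Mealy.S M
mealyState M x zero    = Mealy.s₀ M
mealyState M x (suc n) = proj₁ (Mealy.step M (mealyState M x n) (x n))

mealyRun : {I O : Set} → Mealy I O → Stream I → Stream O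
mealyRun M x n = proj₂ (Mealy.step M (mealyState M x n) (x n))

FiniteStateSync : {I O : Set} → (Stream I → Stream O) → Set₁
FiniteStateSync {I} {O} F =
  Σ (Mealy I O) λ M → ∀ x n → F x n ≡ mealyRun M x n

zipS : {X Y : Set} → Stream X → Stream Y → Stream (X × Y)
zipS x y n = (x n , y n)

record PreAut (S : Set) : Set₁ where
  field
    Q  : Set
    q₀ : Q
    M  : Set
    ∂  : Q → S → M → Q
    Ω  : Stream Q → Set

record IsUniform {S : Set} (A : PreAut S) : Set₁ where
  open PreAut A
  field
    finQ   : Finite Q
    finM   : Finite M
    pointM : M
    regΩ   : OmegaRegular Ω

states : {S : Set} (A : PreAut S) → Stream S → Stream (PreAut.M A) → Stream (PreAut.Q A)
states A σ R zero    = PreAut.q₀ A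
states A σ R (suc k) = PreAut.∂ A (states A σ R k) (σ k) (R k)

Accepting : {S : Set} (A : PreAut S) → Stream S → Stream (PreAut.M A) → Set
Accepting A σ R = PreAut.Ω A (states A σ R)

Lang : {S : Set} (A : PreAut S) → Stream S → Set
Lang A σ = Σ (Stream (PreAut.M A)) λ R → Accepting A σ R

-- underlying maps  (Σ × M(A))^ω → M(B)^ω, written curried
UMap : {S : Set} → PreAut S → PreAut S → Set
UMap {S} A B = Stream S → Stream (PreAut.M A) → Stream (PreAut.M B)

record Hom {S : Set} (A B : PreAut S) : Set₁ where
  field
    F      : UMap A B
    fsync  : FiniteStateSync {S × PreAut.M A} {PreAut.M B}
               (λ w → F (λ n → proj₁ (w n)) (λ n → proj₂ (w n)))
    preserves : ∀ σ R → Accepting A σ R → Accepting B σ (F σ R)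

_∘U_ : {S : Set} {A B C : PreAut S} → UMap B C → UMap A B → UMap A C
(G ∘U F) σ R = G σ (F σ R)

_≈U_ : {S X Y : Set} → (Stream S → Stream X → Stream Y) → (Stream S → Stream X → Stream Y) → Set
F ≈U G = ∀ σ R n → F σ R n ≡ G σ R n

IsTerminal : {S : Set} → PreAut S → Set₁
IsTerminal {S} T =
  (A : PreAut S) → IsUniform A →
  Σ (Hom A T) λ h → (h' : Hom A T) → Hom.F h' ≈U Hom.F h

IsProduct : {S : Set} (A B P : PreAut S) → Hom P A → Hom P B → Set₁
IsProduct {S} A B P π₁ π₂ =
  (C : PreAut S) → IsUniform C → (f : Hom C A) (g : Hom C B) →
  Σ (Hom C P) λ h →
      ((_∘U_ {A = C} {B = P} {C = A} (Hom.F π₁) (Hom.F h)) ≈U Hom.F f)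
    × ((_∘U_ {A = C} {B = P} {C = B} (Hom.F π₂) (Hom.F h)) ≈U Hom.F g)
    × ((h' : Hom C P) →
         (_∘U_ {A = C} {B = P} {C = A} (Hom.F π₁) (Hom.F h')) ≈U Hom.F f →
         (_∘U_ {A = C} {B = P} {C = B} (Hom.F π₂) (Hom.F h')) ≈U Hom.F g →
         Hom.F h' ≈U Hom.F h)

TermAut : (S : Set) → PreAut S
TermAut S = record
  { Q  = ⊤
  ; q₀ = tt
  ; M  = ⊤
  ; ∂  = λ _ _ _ → tt
  ; Ω  = λ _ → ⊤
  }

ProdAut : {S : Set} → PreAut S → PreAut S → PreAut S
ProdAut A B = record
  { Q  = PreAut.Q A × PreAut.Q B
  ; q₀ = (PreAut.q₀ A , PreAut.q₀ B)
  ; M  = PreAut.M A × PreAut.M B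
  ; ∂  = λ { (q , q') a (u , v) → (PreAut.∂ A q a u , PreAut.∂ B q' a v) }
  ; Ω  = λ x → PreAut.Ω A (λ n → proj₁ (x n)) × PreAut.Ω B (λ n → proj₂ (x n))
  }

-- Everything is componentwise except the acceptance condition of A × B:
-- its ω-regularity needs an intersection of Büchi automata, which runs both
-- automata side by side with a flag that waits for an accepting state of the
-- first and then for one of the second; the pair accepts exactly when the
-- flag is raised while the second accepts.
module Submission where

open import Defs
open import Data.Bool using (Bool; true; false; not; _∧_)
open import Data.Bool.Properties using (_≟_; T-≡; not-injective)
open import Data.Nat using (ℕ; zero; suc; _≤_; z≤n; s≤s)
open import Data.Nat.Properties using (≤-refl; ≤-trans; n≤1+n; m≤n⇒m<n∨m≡n)
open import Data.Product using (∃-syntax; _×_; _,_; proj₁; proj₂)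
open import Data.Product.Function.NonDependent.Propositional using (_×-↔_)
open import Data.Sum using (inj₁; inj₂)
open import Data.Unit using (⊤; tt)
open import Data.Fin.Properties using (1↔⊤; 2↔Bool; *↔×)
open import Function using (_∘_; _⇔_; mk⇔; Equivalence)
open import Function.Properties.Inverse using (↔-sym; ↔-trans)
open import Relation.Binary.Definitions using (_Respects_)
open import Relation.Binary.PropositionalEquality
  using (_≡_; refl; sym; trans; cong; cong₂; _≗_)
open import Relation.Nullary.Decidable using (⌊_⌋; toWitness; fromWitness)

finite-⊤ : Finite ⊤
finite-⊤ = 1 , ↔-sym 1↔⊤

finite-Bool : Finite Bool
finite-Bool = 2 , ↔-sym 2↔Bool

finite-× : {X Y : Set} → Finite X → Finite Y → Finite (X × Y)
finite-× (m , X↔m) (n , Y↔n) = _ , ↔-trans (X↔m ×-↔ Y↔n) (↔-sym *↔×)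

∧-elimˡ : ∀ {x y} → x ∧ y ≡ true → x ≡ true
∧-elimˡ {true} _ = refl

∧-elimʳ : ∀ {x y} → x ∧ y ≡ true → y ≡ true
∧-elimʳ {true} y≡true = y≡true

∧-intro : ∀ {x y} → x ≡ true → y ≡ true → x ∧ y ≡ true
∧-intro refl refl = refl

≟-sound : ∀ {c d} → ⌊ c ≟ d ⌋ ≡ true → c ≡ d
≟-sound {c} {d} c≟d = toWitness {a? = c ≟ d} (Equivalence.from T-≡ c≟d)

≟-refl : ∀ c → ⌊ c ≟ c ⌋ ≡ true
≟-refl c = Equivalence.to T-≡ (fromWitness {a? = c ≟ c} refl)

InfinitelyOften : Stream Bool → Set
InfinitelyOften p = ∀ n → ∃[ m ] (n ≤ m × p m ≡ true)

risingEdge : (f : Stream Bool) {k m : ℕ} → k ≤ m → f k ≡ false → f m ≡ true →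
             ∃[ j ] (k ≤ j × f j ≡ false × f (suc j) ≡ true)
risingEdge f {m = zero}  z≤n fk fm with () ← trans (sym fk) fm
risingEdge f {m = suc m} k≤1+m fk fm with m≤n⇒m<n∨m≡n k≤1+m | f m in fm′
... | inj₂ refl        | _     with () ← trans (sym fk) fm
... | inj₁ (s≤s k≤m) | false = m , k≤m , fm′ , fm
... | inj₁ (s≤s k≤m) | true  = risingEdge f k≤m fk fm′

fallingEdge : (f : Stream Bool) {k m : ℕ} → k ≤ m → f k ≡ true → f m ≡ false →
              ∃[ j ] (k ≤ j × f j ≡ true × f (suc j) ≡ false)
fallingEdge f k≤m fk fm =
  let j , k≤j , fj , fj+1 = risingEdge (not ∘ f) k≤m (cong not fk) (cong not fm)
  in  j , k≤j , not-injective fj , not-injective fj+1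

flagStep : Bool → Bool → Bool → Bool
flagStep false a _ = a
flagStep true  _ b = not b

flags : Stream Bool → Stream Bool → Stream Bool
flags a b zero    = false
flags a b (suc n) = flagStep (flags a b n) (a n) (b n)

module Flag {a b f : Stream Bool}
            (step : ∀ n → f (suc n) ≡ flagStep (f n) (a n) (b n)) where

  raise : ∀ {n} → f n ≡ false → f (suc n) ≡ a n
  raise {n} fn = trans (step n) (cong (λ c → flagStep c (a n) (b n)) fn)

  lower : ∀ {n} → f n ≡ true → f (suc n) ≡ not (b n)
  lower {n} fn = trans (step n) (cong (λ c → flagStep c (a n) (b n)) fn)

  raised-after : ∀ {m} → a m ≡ true → ∃[ k ] (m ≤ k × f k ≡ true)
  raised-after {m} am with f m in fm
  ... | true  = m , ≤-refl , fm
  ... | false = suc m , n≤1+n m , trans (raise fm) am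

  caught-after : ∀ {k m} → f k ≡ true → k ≤ m → b m ≡ true →
                 ∃[ j ] (k ≤ j × f j ∧ b j ≡ true)
  caught-after {m = m} fk k≤m bm with f m in fm
  ... | true  = m , k≤m , trans (cong (_∧ b m) fm) bm
  ... | false =
    let j , k≤j , fj , fj+1 = fallingEdge f k≤m fk fm
    in  j , k≤j , ∧-intro fj (not-injective (trans (sym (lower fj)) fj+1))

  infinitelyOften-caught : InfinitelyOften a → InfinitelyOften b →
                           InfinitelyOften (λ n → f n ∧ b n)
  infinitelyOften-caught ioa iob n =
    let m₁ , n≤m₁ , am₁ = ioa n
        k  , m₁≤k , fk  = raised-after am₁
        m₂ , k≤m₂ , bm₂ = iob k
        j  , k≤j  , fbj = caught-after fk k≤m₂ bm₂
    in  j , ≤-trans n≤m₁ (≤-trans m₁≤k k≤j) , fbj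

  -- Between two catches the flag is lowered and raised again, and only an
  -- event of a raises it.
  infinitelyOften-raising : InfinitelyOften (λ n → f n ∧ b n) → InfinitelyOften a
  infinitelyOften-raising io n =
    let m  , n≤m    , fbm  = io n
        m′ , 1+m≤m′ , fbm′ = io (suc m)
        f1+m = trans (lower (∧-elimˡ fbm)) (cong not (∧-elimʳ fbm))
        j  , 1+m≤j , fj , fj+1 = risingEdge f 1+m≤m′ f1+m (∧-elimˡ fbm′)
    in  j , ≤-trans n≤m (≤-trans (n≤1+n m) 1+m≤j) , trans (sym (raise fj)) fj+1

buchiAccepts-resp-≗ : {Q : Set} (B : Buchi Q) → BuchiAccepts B Respects _≗_
buchiAccepts-resp-≗ B x≗y (r , r₀ , δr , accr) =
  r , r₀ , (λ n → trans (cong (λ q → Buchi.δ B (r n) q (r (suc n))) (sym (x≗y n))) (δr n)) , accr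

omegaRegular-resp-≗ : {Q : Set} {Ω : Stream Q → Set} → OmegaRegular Ω → Ω Respects _≗_
omegaRegular-resp-≗ (B , Ω⇔B) x≗y Ωx =
  proj₂ (Ω⇔B _) (buchiAccepts-resp-≗ B x≗y (proj₁ (Ω⇔B _) Ωx))

omegaRegular-⊤ : {Q : Set} → OmegaRegular {Q} (λ _ → ⊤)
omegaRegular-⊤ = B , λ _ → (λ _ → (λ _ → tt) , refl , (λ _ → refl) , λ n → n , ≤-refl , refl) , _
  where
  B : Buchi _
  B = record { St = ⊤ ; finSt = finite-⊤ ; init = tt
             ; δ = λ _ _ _ → true ; accept = λ _ → true }

module Intersection {Q₁ Q₂ : Set} (B₁ : Buchi Q₁) (B₂ : Buchi Q₂) where
  open Buchi B₁ renaming (St to St₁; init to init₁; δ to δ₁; accept to accept₁)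
  open Buchi B₂ renaming (St to St₂; init to init₂; δ to δ₂; accept to accept₂)

  B₁∩B₂ : Buchi (Q₁ × Q₂)
  B₁∩B₂ = record
    { St     = St₁ × St₂ × Bool
    ; finSt  = finite-× (Buchi.finSt B₁) (finite-× (Buchi.finSt B₂) finite-Bool)
    ; init   = init₁ , init₂ , false
    ; δ      = λ { (s₁ , s₂ , c) (x₁ , x₂) (s₁′ , s₂′ , c′) →
                   δ₁ s₁ x₁ s₁′ ∧ δ₂ s₂ x₂ s₂′ ∧ ⌊ c′ ≟ flagStep c (accept₁ s₁) (accept₂ s₂) ⌋ }
    ; accept = λ { (_ , s₂ , c) → c ∧ accept₂ s₂ }
    }

  complete : ∀ x → BuchiAccepts B₁ (proj₁ ∘ x) → BuchiAccepts B₂ (proj₂ ∘ x) →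
             BuchiAccepts B₁∩B₂ x
  complete x (r₁ , r₁₀ , δr₁ , io₁) (r₂ , r₂₀ , δr₂ , io₂) =
    (λ n → r₁ n , r₂ n , f n) ,
    cong₂ (λ s₁ s₂ → s₁ , s₂ , false) r₁₀ r₂₀ ,
    (λ n → ∧-intro (δr₁ n) (∧-intro (δr₂ n) (≟-refl (f (suc n))))) ,
    Flag.infinitelyOften-caught {f = f} (λ _ → refl) io₁ io₂
    where
    f : Stream Bool
    f = flags (accept₁ ∘ r₁) (accept₂ ∘ r₂)

  sound : ∀ x → BuchiAccepts B₁∩B₂ x →
          BuchiAccepts B₁ (proj₁ ∘ x) × BuchiAccepts B₂ (proj₂ ∘ x)
  sound x (r , r₀ , δr , io) =
    (r₁ , cong proj₁ r₀ , ∧-elimˡ ∘ δr , Flag.infinitelyOften-raising {f = f} step io) ,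
    (r₂ , cong (proj₁ ∘ proj₂) r₀ , ∧-elimˡ ∘ δr₂∧flag ,
     λ n → let m , n≤m , accm = io n in m , n≤m , ∧-elimʳ accm)
    where
    r₁ : Stream St₁
    r₁ = proj₁ ∘ r
    r₂ : Stream St₂
    r₂ = proj₁ ∘ proj₂ ∘ r
    f : Stream Bool
    f = proj₂ ∘ proj₂ ∘ r

    δr₂∧flag : ∀ n → δ₂ (r₂ n) (proj₂ (x n)) (r₂ (suc n))
                     ∧ ⌊ f (suc n) ≟ flagStep (f n) (accept₁ (r₁ n)) (accept₂ (r₂ n)) ⌋ ≡ true
    δr₂∧flag n = ∧-elimʳ {δ₁ (r₁ n) (proj₁ (x n)) (r₁ (suc n))} (δr n)

    step : ∀ n → f (suc n) ≡ flagStep (f n) (accept₁ (r₁ n)) (accept₂ (r₂ n))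
    step n = ≟-sound (∧-elimʳ {δ₂ (r₂ n) (proj₂ (x n)) (r₂ (suc n))} (δr₂∧flag n))

omegaRegular-× : {Q₁ Q₂ : Set} {Ω₁ : Stream Q₁ → Set} {Ω₂ : Stream Q₂ → Set} →
                 OmegaRegular Ω₁ → OmegaRegular Ω₂ →
                 OmegaRegular (λ x → Ω₁ (proj₁ ∘ x) × Ω₂ (proj₂ ∘ x))
omegaRegular-× (B₁ , Ω₁⇔B₁) (B₂ , Ω₂⇔B₂) = B₁∩B₂ , λ x →
  (λ (Ω₁x , Ω₂x) → complete x (proj₁ (Ω₁⇔B₁ _) Ω₁x) (proj₁ (Ω₂⇔B₂ _) Ω₂x)) ,
  (λ acc → let acc₁ , acc₂ = sound x acc in proj₂ (Ω₁⇔B₁ _) acc₁ , proj₂ (Ω₂⇔B₂ _) acc₂)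
  where open Intersection B₁ B₂

pointwise-sync : {I O : Set} (g : I → O) → FiniteStateSync (λ x n → g (x n))
pointwise-sync g =
  record { S = ⊤ ; finS = finite-⊤ ; s₀ = tt ; step = λ _ i → tt , g i } , λ _ _ → refl

_⊗ᴹ_ : {I O₁ O₂ : Set} → Mealy I O₁ → Mealy I O₂ → Mealy I (O₁ × O₂)
M₁ ⊗ᴹ M₂ = record
  { S    = Mealy.S M₁ × Mealy.S M₂
  ; finS = finite-× (Mealy.finS M₁) (Mealy.finS M₂)
  ; s₀   = Mealy.s₀ M₁ , Mealy.s₀ M₂
  ; step = λ (s₁ , s₂) i →
             let s₁′ , o₁ = Mealy.step M₁ s₁ i
                 s₂′ , o₂ = Mealy.step M₂ s₂ i
             in  (s₁′ , s₂′) , (o₁ , o₂)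
  }

mealyState-⊗ : {I O₁ O₂ : Set} (M₁ : Mealy I O₁) (M₂ : Mealy I O₂) (x : Stream I) →
               mealyState (M₁ ⊗ᴹ M₂) x ≗ (λ n → mealyState M₁ x n , mealyState M₂ x n)
mealyState-⊗ M₁ M₂ x zero    = refl
mealyState-⊗ M₁ M₂ x (suc n) =
  cong (λ s → proj₁ (Mealy.step (M₁ ⊗ᴹ M₂) s (x n))) (mealyState-⊗ M₁ M₂ x n)

mealyRun-⊗ : {I O₁ O₂ : Set} (M₁ : Mealy I O₁) (M₂ : Mealy I O₂) (x : Stream I) →
             mealyRun (M₁ ⊗ᴹ M₂) x ≗ (λ n → mealyRun M₁ x n , mealyRun M₂ x n)
mealyRun-⊗ M₁ M₂ x n = cong (λ s → proj₂ (Mealy.step (M₁ ⊗ᴹ M₂) s (x n))) (mealyState-⊗ M₁ M₂ x n)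

pair-sync : {I O₁ O₂ : Set} {F : Stream I → Stream O₁} {G : Stream I → Stream O₂} →
            FiniteStateSync F → FiniteStateSync G → FiniteStateSync (λ x n → F x n , G x n)
pair-sync (M₁ , F≡M₁) (M₂ , G≡M₂) =
  M₁ ⊗ᴹ M₂ , λ x n → trans (cong₂ _,_ (F≡M₁ x n) (G≡M₂ x n)) (sym (mealyRun-⊗ M₁ M₂ x n))

module _ {S : Set} (A B : PreAut S) where

  states-proj₁ : ∀ σ R → proj₁ ∘ states (ProdAut A B) σ R ≗ states A σ (proj₁ ∘ R)
  states-proj₁ σ R zero    = refl
  states-proj₁ σ R (suc n) = cong (λ q → PreAut.∂ A q (σ n) (proj₁ (R n))) (states-proj₁ σ R n)

  states-proj₂ : ∀ σ R → proj₂ ∘ states (ProdAut A B) σ R ≗ states B σ (proj₂ ∘ R)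
  states-proj₂ σ R zero    = refl
  states-proj₂ σ R (suc n) = cong (λ q → PreAut.∂ B q (σ n) (proj₂ (R n))) (states-proj₂ σ R n)

  accepting-ProdAut : PreAut.Ω A Respects _≗_ → PreAut.Ω B Respects _≗_ → ∀ σ R →
    Accepting (ProdAut A B) σ R ⇔ (Accepting A σ (proj₁ ∘ R) × Accepting B σ (proj₂ ∘ R))
  accepting-ProdAut respA respB σ R = mk⇔
    (λ (accA , accB) → respA (states-proj₁ σ R) accA , respB (states-proj₂ σ R) accB)
    (λ (accA , accB) → respA (sym ∘ states-proj₁ σ R) accA , respB (sym ∘ states-proj₂ σ R) accB)

module Product {S : Set} (A B : PreAut S) (uA : IsUniform A) (uB : IsUniform B) where

  P : PreAut S
  P = ProdAut A B

  accepting-P : ∀ σ R → Accepting P σ R ⇔ (Accepting A σ (proj₁ ∘ R) × Accepting B σ (proj₂ ∘ R))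
  accepting-P = accepting-ProdAut A B (omegaRegular-resp-≗ (IsUniform.regΩ uA))
                                      (omegaRegular-resp-≗ (IsUniform.regΩ uB))

  uniform : IsUniform P
  uniform = record
    { finQ   = finite-× (IsUniform.finQ uA) (IsUniform.finQ uB)
    ; finM   = finite-× (IsUniform.finM uA) (IsUniform.finM uB)
    ; pointM = IsUniform.pointM uA , IsUniform.pointM uB
    ; regΩ   = omegaRegular-× (IsUniform.regΩ uA) (IsUniform.regΩ uB)
    }

  π₁ : Hom P A
  π₁ = record
    { F         = λ _ R → proj₁ ∘ R
    ; fsync     = pointwise-sync (proj₁ ∘ proj₂)
    ; preserves = λ σ R → proj₁ ∘ Equivalence.to (accepting-P σ R)
    }

  π₂ : Hom P B
  π₂ = record
    { F         = λ _ R → proj₂ ∘ R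
    ; fsync     = pointwise-sync (proj₂ ∘ proj₂)
    ; preserves = λ σ R → proj₂ ∘ Equivalence.to (accepting-P σ R)
    }

  ⟨_,_⟩ : {C : PreAut S} → Hom C A → Hom C B → Hom C P
  ⟨ f , g ⟩ = record
    { F         = λ σ R n → Hom.F f σ R n , Hom.F g σ R n
    ; fsync     = pair-sync (Hom.fsync f) (Hom.fsync g)
    ; preserves = λ σ R accR →
        Equivalence.from (accepting-P σ _) (Hom.preserves f σ R accR , Hom.preserves g σ R accR)
    }

  isProduct : IsProduct A B P π₁ π₂
  isProduct C _ f g = ⟨ f , g ⟩ , (λ _ _ _ → refl) , (λ _ _ _ → refl) ,
    λ h π₁∘h≈f π₂∘h≈g σ R n → cong₂ _,_ (π₁∘h≈f σ R n) (π₂∘h≈g σ R n)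

  lang-P : ∀ σ → Lang P σ ⇔ (Lang A σ × Lang B σ)
  lang-P σ = mk⇔
    (λ (R , accR) → let accA , accB = Equivalence.to (accepting-P σ R) accR
                    in  (proj₁ ∘ R , accA) , (proj₂ ∘ R , accB))
    (λ ((RA , accA) , (RB , accB)) →
       zipS RA RB , Equivalence.from (accepting-P σ (zipS RA RB)) (accA , accB))

TermAut-uniform : (S : Set) → IsUniform (TermAut S)
TermAut-uniform S = record
  { finQ = finite-⊤ ; finM = finite-⊤ ; pointM = tt ; regΩ = omegaRegular-⊤ }

TermAut-terminal : (S : Set) → IsTerminal (TermAut S)
TermAut-terminal S A _ =
  record { F = λ _ _ _ → tt ; fsync = pointwise-sync _ ; preserves = _ } ,
  λ _ _ _ _ → refl

proposition5p6 :
    (S : Set) → IsAlphabet S →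
      -- the terminal object
      (IsUniform (TermAut S) × IsTerminal (TermAut S)
        × (∀ σ → Lang (TermAut S) σ))
    × -- binary products
      ((A B : PreAut S) → IsUniform A → IsUniform B →
        IsUniform (ProdAut A B)
        × (∃[ π₁ ] ∃[ π₂ ] IsProduct A B (ProdAut A B) π₁ π₂)
        × (∀ σ → (Lang (ProdAut A B) σ → Lang A σ × Lang B σ)
                × (Lang A σ × Lang B σ → Lang (ProdAut A B) σ)))
proposition5p6 S _ =
  (TermAut-uniform S , TermAut-terminal S , λ _ → _ , tt) ,
  λ A B uA uB → let open Product A B uA uB in
    uniform , (π₁ , π₂ , isProduct) ,
    λ σ → Equivalence.to (lang-P σ) , Equivalence.from (lang-P σ)
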